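{- For all integers $c,k\ge1$, every hypergraph $H_k^c$ (constructed as in the context) admits a realization by axis-parallel rectangles whose $y$-projections form a nested family; that is, there exist a finite set $P\subset\mathbb{R}^2$, a bijection $\varphi$ from the vertex set of $H_k^c$ to $P$, and a family $\mathcal{R}$ of axis-parallel rectangles whose $y$-projections form a nested family, such that $\varphi$ maps the edge set of $H_k^c$ onto $\{P\cap R: R\in\mathcal{R}\}$.
   Context: For a linearly ordered set $A=\{a_1<a_2<\dots<a_{tm}\}$, its blocks are $\{a_{im+1},\dots,a_{im+m}\}$, $i=0,\dots,t-1$, and $f_m(A)$ is the family of subsets of $A$ containing exactly one element of each block. Fix $k\ge1$. The vertex-ordered hypergraphs $H_k^c$ are defined recursively in $c$. $H_k^1$: $k$ vertices with an arbitrary linear order and one edge consisting of all $k$ vertices. For $c>1$, take some $H_k^{c-1}$ and let $m$ be its number of vertices. Build a rooted forest whose vertices are partitioned into stages; a stage $S$ of level $j$ is a set of $m^{k-j}$ vertices with a linear order $<_S$. There is one stage of level $0$: $m^k$ vertices in some order, the roots. For each stage $S$ of level $j<k-1$ and each $S'\in f_m(S)$, create a new stage $T(S')$ of level $j+1$ consisting of $m^{k-j-1}$ new vertices, one child of each vertex of $S'$, ordered as their parents are ordered in $<_S$. Stages of level $k-1$ have no children. The vertex set of $H_k^c$ is the set of all forest vertices. Edges: (path edges) for each vertex $v$ in a stage of level $k-1$, the vertex set of the forest path from $v$ to its root; (transversal edges) for each stage $S$ of level $j$, partition $S$ into its $m^{k-j-1}$ blocks of $m$ consecutive vertices in $<_S$,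 and on each block place the edges of a copy of $H_k^{c-1}$ via the order-preserving bijection from the vertices of $H_k^{c-1}$ to the block. $H_k^c$ is given an arbitrary linear order of its vertices. An axis-parallel rectangle is a set $\{(x,y): x_1\le x\le x_2,\ y_1\le y\le y_2\}$, with $y$-projection $[y_1,y_2]$. A family of intervals (repetitions allowed) is nested if any two members $A,B$ satisfy $A\subseteq B$, $B\subseteq A$ or $A\cap B=\emptyset$. -}

module Defs where

open import Data.Nat using (ℕ; zero; suc; _*_; _∸_)
open import Data.Fin using (Fin; combine)
open import Data.Fin.Subset using (Subset; ⊤) renaming (_∈_ to _∈ₛ_)
open import Data.Vec using (Vec; lookup)
open import Data.List using (List; _∷_; [])
open import Data.List.Membership.Propositional using () renaming (_∈_ to _∈ₗ_)
open import Data.Product using (Σ; ∃; _×_; _,_)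
open import Data.Sum using (_⊎_)
open import Data.Empty using (⊥)
open import Relation.Nullary using (¬_)
open import Relation.Binary.PropositionalEquality using (_≡_)
open import Function.Bundles using (_⇔_; _↔_; Inverse)
open import Function.Definitions using (Injective)
open import Data.Rational using (ℚ; _≤_)

-- Vertex-ordered hypergraphs: vertices Fin n (ordered as Fin n),
-- edges a finite family of subsets of the vertex set.

record Hyp : Set where
  field
    n     : ℕ
    edges : List (Subset n)
open Hyp public

-- We index stages by their HEIGHT h = (k-1) - level, so the
-- root stage has height top = k-1 and stages of level k-1 have height 0.
-- pw m h = m^h (with multiplication on the right so that a stage of
-- height h has pw m (suc h) = pw m h * m vertices, i.e. pw m h blocks of m).

pw : ℕ → ℕ → ℕ
pw m zero    = 1
pw m (suc h) = pw m h * m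

-- A child stage
-- T(S') of a stage S of height suc h is determined by S and by
-- S' ∈ f_m(S), given as the chosen element (offset in Fin m) of each of
-- the pw m (suc h) blocks of S.  T(S') has pw m (suc h) vertices, the
-- i-th one being the child of the chosen element of block i of S
-- (this is the order inherited from the parents).
data Stage (m top : ℕ) : ℕ → Set where
  root  : Stage m top top
  child : ∀ {h} → Stage m top (suc h) → Vec (Fin m) (pw m (suc h)) → Stage m top h

-- Forest vertices: a stage together with a position in its order <_S.
-- Position combine b u (= b*m + u) is the u-th element of block b.
Vtx : ℕ → ℕ → Set
Vtx m top = Σ ℕ λ h → Stage m top h × Fin (pw m (suc h))

InPath : ∀ {m top h} → Stage m top h → Fin (pw m (suc h)) → Vtx m top → Set
InPath {h = h} root        i w = w ≡ (h , root , i)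
InPath {h = h} (child S c) i w =
  (w ≡ (h , child S c , i)) ⊎ InPath S (combine i (lookup c i)) w

-- Edges of H_k^c built from G = H_k^{c-1} (before relabelling).
data FEdge (G : Hyp) (top : ℕ) : Set where
  pathE  : Stage (n G) top 0 → Fin (pw (n G) 1) → FEdge G top
  transE : (h : ℕ) → Stage (n G) top h → Fin (pw (n G) h) →
           (e : Subset (n G)) → e ∈ₗ edges G → FEdge G top

memF : ∀ {G top} → FEdge G top → Vtx (n G) top → Set
memF (pathE S i) w = InPath S i w
memF {G} (transE h S b e _) w =
  Σ (Fin (n G)) λ u → (u ∈ₛ e) × (w ≡ (h , S , combine b u))

-- H is (a vertex-ordering of) the hypergraph built from G: a bijection
-- β from the (ordered) vertex set Fin (n H) onto the forest vertices
-- under which the edge set of H is exactly the edge set built above.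
record BuiltFrom (k : ℕ) (G H : Hyp) : Set where
  field
    β      : Fin (n H) ↔ Vtx (n G) (k ∸ 1)
    edges⊆ : ∀ e → e ∈ₗ edges H →
             Σ (FEdge G (k ∸ 1)) λ f → ∀ x → (x ∈ₛ e) ⇔ memF f (Inverse.to β x)
    edges⊇ : ∀ (f : FEdge G (k ∸ 1)) →
             Σ (Subset (n H)) λ e → (e ∈ₗ edges H) ×
               (∀ x → (x ∈ₛ e) ⇔ memF f (Inverse.to β x))

data IsH (k : ℕ) : ℕ → Hyp → Set where
  base : IsH k 1 (record { n = k ; edges = ⊤ ∷ [] })
  step : ∀ {c G H} → IsH k c G → BuiltFrom k G H → IsH k (suc c) H

Point : Set
Point = ℚ × ℚ

record Rect : Set where
  constructor rect
  field
    x₁ x₂ y₁ y₂ : ℚ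
open Rect public

_∈R_ : Point → Rect → Set
(x , y) ∈R R = (x₁ R ≤ x × x ≤ x₂ R) × (y₁ R ≤ y × y ≤ y₂ R)

record Interval : Set where
  constructor [_,_]
  field
    lo hi : ℚ
open Interval public

_∈I_ : ℚ → Interval → Set
y ∈I I = lo I ≤ y × y ≤ hi I

yProj : Rect → Interval
yProj R = [ y₁ R , y₂ R ]

NestedPair : Interval → Interval → Set
NestedPair A B =
  (∀ y → y ∈I A → y ∈I B) ⊎ (∀ y → y ∈I B → y ∈I A) ⊎
  (∀ y → ¬ (y ∈I A × y ∈I B))

NestedFamily : List Interval → Set
NestedFamily Is = ∀ A B → A ∈ₗ Is → B ∈ₗ Is → NestedPair A B

yProjs : List Rect → List Interval
yProjs []       = []
yProjs (R ∷ Rs) = yProj R ∷ yProjs Rs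

-- φ : Fin (n H) → ℚ² injective, P = image of φ (so φ is a bijection onto
-- P); φ maps each edge e to P ∩ R iff ∀ x, x ∈ e ⇔ φ x ∈ R.
RealizedBy : (H : Hyp) → (Fin (n H) → Point) → List Rect → Set
RealizedBy H φ ℛ =
  (∀ e → e ∈ₗ edges H → Σ Rect λ R → (R ∈ₗ ℛ) × (∀ x → (x ∈ₛ e) ⇔ (φ x ∈R R))) ×
  (∀ R → R ∈ₗ ℛ → Σ (Subset (n H)) λ e → (e ∈ₗ edges H) × (∀ x → (x ∈ₛ e) ⇔ (φ x ∈R R)))

NestedRectRealization : Hyp → Set
NestedRectRealization H =
  Σ (Fin (n H) → Point) λ φ → Injective _≡_ _≡_ φ ×
  Σ (List Rect) λ ℛ → NestedFamily (yProjs ℛ) × RealizedBy H φ ℛ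

module Submission where

-- The realization is built on the integer grid by induction on c and moved to ℚ at the end.
-- Given a realization (x, y) of H_k^{c-1}, a vertex of H_k^c at position i of a stage S gets
--   X = the word: x-coordinates of the base-m digits of the position of its root ancestor,
--       followed by the address of S (the choices made on the way down from the root),
--   Y = the y-coordinate of its offset in its block, placed in a horizontal band of S,
-- where words are read as numbers through an order-preserving encoding, and the bands are
-- sorted by the addresses compared letter-wise in reverse.  A block of a stage is then an
-- interval of X-words sharing a prefix inside one band, so every rectangle of H_k^{c-1}
-- transfers to it.  The path edge of a leaf v becomes the rectangle from its root to v in X
-- and from 0 to v's band in Y: a vertex with the same root lies in it iff the address of its
-- stage precedes v's address both lexicographically and in reverse, i.e. is a prefix.  Bands are
-- disjoint and all path rectangles start at 0, so the y-projections stay nested.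

open import Defs
open import Data.Nat using (ℕ; zero; suc; _+_; _*_; _∸_; _^_; _≤_; _<_; _>_; z≤n; s≤s; z<s)
open import Data.Nat.Properties
open import Data.Fin as Fin using (Fin; toℕ; combine; quotient; remainder)
open import Data.Fin.Properties using (toℕ<n; toℕ-injective; combine-injective; remQuot-combine; combine-remQuot)
open import Data.Fin.Subset using (Subset; ⊤) renaming (_∈_ to _∈ₛ_)
open import Data.Fin.Subset.Properties using (∈⊤)
open import Data.Vec using (Vec; []; _∷_; lookup)
open import Data.List using (List; []; _∷_; _++_; [_]; _∷ʳ_; length; map)
open import Data.List.Properties using (∷-injective; ∷ʳ-++; length-++; length-map; ++-identityʳ; ++-assoc; ∷ʳ-injective)
open import Data.List.Relation.Unary.All as All using (All; []; _∷_)
import Data.List.Relation.Unary.All.Properties as All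
open import Data.List.Relation.Unary.Any using (here; there)
open import Data.List.Membership.Propositional using () renaming (_∈_ to _∈ₗ_)
open import Data.List.Membership.Propositional.Properties using (∈-map⁺; ∈-map⁻)
open import Data.List.Relation.Binary.Lex.Strict using (Lex-≤; base; halt; this; next)
import Data.List.Relation.Binary.Lex.Strict as Lex
open import Data.List.Relation.Binary.Prefix.Heterogeneous using (Prefix; []; _∷_; _++ᵖ_) renaming (map to Prefix-map)
import Data.List.Relation.Binary.Prefix.Heterogeneous.Properties as Prefix
open import Data.List.Relation.Binary.Pointwise using (Pointwise-≡⇒≡)
import Data.List.Relation.Binary.Pointwise as Pointwise
open import Data.Product using (Σ; ∃-syntax; _×_; _,_; proj₁; proj₂)
open import Data.Sum using (_⊎_; inj₁; inj₂)
open import Data.Empty using (⊥-elim)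
open import Function.Base using (_∘_; flip)
open import Function.Bundles using (_⇔_; mk⇔; Equivalence; Inverse; Injection)
open import Function.Definitions using (Injective)
open import Function.Properties.Inverse using (↔⇒↣)
import Function.Properties.Equivalence as ⇔
open import Relation.Binary.Core using (Rel)
open import Relation.Binary.Definitions using (Irreflexive; Asymmetric; tri<; tri≈; tri>)
open import Relation.Binary.PropositionalEquality hiding ([_])
open import Relation.Nullary using (contradiction)
open import Data.Rational as ℚ using (ℚ; mkℚ; *≤*)
import Data.Rational.Properties as ℚ
import Data.Integer as ℤ
import Data.Integer.Properties as ℤ
import Data.Nat.Coprimality as Coprime

-- Lexicographic order on lists

module _ {A : Set} {_≺_ : A → A → Set} where

  Prefix⇒Lex-≤ : ∀ {as bs} → Prefix _≡_ as bs → Lex-≤ _≡_ _≺_ as bs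
  Prefix⇒Lex-≤ {bs = []}    [] = base _
  Prefix⇒Lex-≤ {bs = _ ∷ _} [] = halt
  Prefix⇒Lex-≤ (a≡b ∷ p)       = next a≡b (Prefix⇒Lex-≤ p)

  Lex-≤-++⁺ˡ : ∀ ps {as bs} → Lex-≤ _≡_ _≺_ as bs → Lex-≤ _≡_ _≺_ (ps ++ as) (ps ++ bs)
  Lex-≤-++⁺ˡ []       as≤bs = as≤bs
  Lex-≤-++⁺ˡ (p ∷ ps) as≤bs = next refl (Lex-≤-++⁺ˡ ps as≤bs)

  Lex-≤-++⁻ˡ : Irreflexive _≡_ _≺_ → ∀ ps {as bs} →
               Lex-≤ _≡_ _≺_ (ps ++ as) (ps ++ bs) → Lex-≤ _≡_ _≺_ as bs
  Lex-≤-++⁻ˡ irr []       as≤bs        = as≤bs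
  Lex-≤-++⁻ˡ irr (p ∷ ps) (this p≺p)   = ⊥-elim (irr refl p≺p)
  Lex-≤-++⁻ˡ irr (p ∷ ps) (next _ ≤ps) = Lex-≤-++⁻ˡ irr ps ≤ps

  Lex-≤-++-equalLength : ∀ {ps qs as bs} → length ps ≡ length qs →
                         Lex-≤ _≡_ _≺_ (ps ++ as) (qs ++ bs) → Lex-≤ _≡_ _≺_ ps qs
  Lex-≤-++-equalLength {[]}    {[]}    _   _              = base _
  Lex-≤-++-equalLength {_ ∷ _} {_ ∷ _} _   (this p≺q)     = this p≺q
  Lex-≤-++-equalLength {_ ∷ _} {_ ∷ _} len (next p≡q ≤ps) =
    next p≡q (Lex-≤-++-equalLength (suc-injective len) ≤ps)

  Lex-≤-both⇒Prefix : Asymmetric _≺_ → ∀ {as bs} →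
                      Lex-≤ _≡_ _≺_ as bs → Lex-≤ _≡_ (flip _≺_) as bs → Prefix _≡_ as bs
  Lex-≤-both⇒Prefix asym (base _)        _                = []
  Lex-≤-both⇒Prefix asym halt            _                = []
  Lex-≤-both⇒Prefix asym (this a≺b)      (this b≺a)       = ⊥-elim (asym a≺b b≺a)
  Lex-≤-both⇒Prefix asym (this a≺a)      (next refl _)    = ⊥-elim (asym a≺a a≺a)
  Lex-≤-both⇒Prefix asym (next refl _)   (this a≺a)       = ⊥-elim (asym a≺a a≺a)
  Lex-≤-both⇒Prefix asym (next refl ≤as) (next refl ≥as)  = refl ∷ Lex-≤-both⇒Prefix asym ≤as ≥as

prefix-∷ʳ⁻ : ∀ {A : Set} {as : List A} bs {b} →
             Prefix _≡_ as (bs ∷ʳ b) → Prefix _≡_ as bs ⊎ as ≡ bs ∷ʳ b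
prefix-∷ʳ⁻ []       []          = inj₁ []
prefix-∷ʳ⁻ []       (refl ∷ []) = inj₂ refl
prefix-∷ʳ⁻ (_ ∷ _)  []          = inj₁ []
prefix-∷ʳ⁻ (_ ∷ bs) (refl ∷ p) with prefix-∷ʳ⁻ bs p
... | inj₁ p′   = inj₁ (refl ∷ p′)
... | inj₂ refl = inj₂ refl

∷ʳ≢[] : ∀ {A : Set} (as : List A) {a} → as ∷ʳ a ≢ []
∷ʳ≢[] []      ()
∷ʳ≢[] (_ ∷ _) ()

++-cancel-equalLength : ∀ {A : Set} (ps qs : List A) {as bs} → length ps ≡ length qs →
                        ps ++ as ≡ qs ++ bs → ps ≡ qs × as ≡ bs
++-cancel-equalLength []       []       _   eq = refl , eq
++-cancel-equalLength (p ∷ ps) (q ∷ qs) len eq with ∷-injective eq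
... | refl , eq′ with ++-cancel-equalLength ps qs (suc-injective len) eq′
... | refl , as≡bs = refl , as≡bs

prefix-[]⁻ : ∀ {A : Set} {as : List A} → Prefix _≡_ as [] → as ≡ []
prefix-[]⁻ [] = refl

infix 4 _≤ₗₑₓ_

_≤ₗₑₓ_ : Rel (List ℕ) _
_≤ₗₑₓ_ = Lex-≤ _≡_ _<_

≤ₗₑₓ-antisym : ∀ {as bs} → as ≤ₗₑₓ bs → bs ≤ₗₑₓ as → as ≡ bs
≤ₗₑₓ-antisym as≤bs bs≤as = Pointwise-≡⇒≡ (Lex.≤-antisymmetric sym <-irrefl <-asym as≤bs bs≤as)

≤ₗₑₓ-head : ∀ {a b as bs} → (a ∷ as) ≤ₗₑₓ (b ∷ bs) → a ≤ b
≤ₗₑₓ-head (this a<b)    = <⇒≤ a<b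
≤ₗₑₓ-head (next refl _) = ≤-refl

singleton-≤ₗₑₓ : ∀ {a b} bs → a ≤ b → [ a ] ≤ₗₑₓ b ∷ bs
singleton-≤ₗₑₓ bs a≤b with m≤n⇒m<n∨m≡n a≤b
... | inj₁ a<b = this a<b
singleton-≤ₗₑₓ []      _ | inj₂ refl = next refl (base _)
singleton-≤ₗₑₓ (_ ∷ _) _ | inj₂ refl = next refl halt

∷-≤ₗₑₓ-sentinel : ∀ {a b c as} → a ≤ b → All (_< c) as → a ∷ as ≤ₗₑₓ b ∷ c ∷ []
∷-≤ₗₑₓ-sentinel a≤b as<c with m≤n⇒m<n∨m≡n a≤b
... | inj₁ a<b = this a<b
∷-≤ₗₑₓ-sentinel _ []          | inj₂ refl = next refl halt
∷-≤ₗₑₓ-sentinel _ (a′<c ∷ _)  | inj₂ refl = next refl (this a′<c)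

module _ (C : ℕ) where

  map-∸-≤ₗₑₓ⁻ : ∀ {as bs} → All (_≤ C) as → All (_≤ C) bs →
                map (C ∸_) as ≤ₗₑₓ map (C ∸_) bs → Lex-≤ _≡_ _>_ as bs
  map-∸-≤ₗₑₓ⁻ []          []          (base _)    = base _
  map-∸-≤ₗₑₓ⁻ []          (_ ∷ _)     halt        = halt
  map-∸-≤ₗₑₓ⁻ (_ ∷ _)     (_ ∷ _)     (this lt)   = this (≰⇒> (λ a≤b → <⇒≱ lt (∸-monoʳ-≤ C a≤b)))
  map-∸-≤ₗₑₓ⁻ (a≤C ∷ as)  (b≤C ∷ bs)  (next eq l) = next (∸-cancelˡ-≡ a≤C b≤C eq) (map-∸-≤ₗₑₓ⁻ as bs l)

  map-∸-injective : ∀ {as bs} → All (_≤ C) as → All (_≤ C) bs →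
                    map (C ∸_) as ≡ map (C ∸_) bs → as ≡ bs
  map-∸-injective []         []         _  = refl
  map-∸-injective (a≤C ∷ as) (b≤C ∷ bs) eq with ∷-injective eq
  ... | head≡ , tail≡ = cong₂ _∷_ (∸-cancelˡ-≡ a≤C b≤C head≡) (map-∸-injective as bs tail≡)

positional-bound : ∀ {P Q e s} → e < P → s < Q → e * Q + s < P * Q
positional-bound {P} {Q} {e} {s} e<P s<Q = begin-strict
  e * Q + s  <⟨ +-monoʳ-< (e * Q) s<Q ⟩
  e * Q + Q  ≡⟨ +-comm (e * Q) Q ⟩
  suc e * Q  ≤⟨ *-monoˡ-≤ Q e<P ⟩
  P * Q      ∎
  where open ≤-Reasoning

positional-< : ∀ {P e e′ s} s′ → s < P → e < e′ → e * P + s < e′ * P + s′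
positional-< s′ s<P e<e′ = <-≤-trans (positional-bound e<e′ s<P) (m≤m+n _ s′)

positional-≤⁻ : ∀ {P e e′ s s′} → s′ < P → e * P + s ≤ e′ * P + s′ → e ≤ e′
positional-≤⁻ {e = e} {e′} s′<P le with <-cmp e e′
... | tri< e<e′ _ _ = <⇒≤ e<e′
... | tri≈ _ refl _ = ≤-refl
... | tri> _ _ e′<e = contradiction le (<⇒≱ (positional-< _ s′<P e′<e))

-- Words of length at most L over {0, …, M}, read as numbers in base M + 2 with every letter
-- shifted up by one, so that a proper prefix is encoded below its extensions.  The clause for
-- words longer than L is junk: such words do not satisfy Fits.

module LexEncoding (M : ℕ) where

  radix : ℕ
  radix = suc (suc M)

  encode : ℕ → List ℕ → ℕ
  encode _       []       = 0
  encode zero    (_ ∷ _)  = 0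
  encode (suc L) (d ∷ ds) = suc d * radix ^ L + encode L ds

  Fits : ℕ → List ℕ → Set
  Fits L ds = length ds ≤ L × All (_≤ M) ds

  encode<radix^ : ∀ L {ds} → Fits L ds → encode L ds < radix ^ L
  encode<radix^ L       {[]}     _                   = m^n>0 radix L
  encode<radix^ (suc L) {d ∷ ds} (s≤s len , d≤M ∷ ok) =
    positional-bound (s≤s (s≤s d≤M)) (encode<radix^ L (len , ok))

  encode-head-< : ∀ L {a b as} bs → Fits L as → a < b →
                  encode (suc L) (a ∷ as) < encode (suc L) (b ∷ bs)
  encode-head-< L bs fits a<b = positional-< _ (encode<radix^ L fits) (s≤s a<b)

  encode-mono : ∀ L {as bs} → Fits L as → Fits L bs → as ≤ₗₑₓ bs → encode L as ≤ encode L bs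
  encode-mono L       _                    _                    (base _)      = ≤-refl
  encode-mono L       _                    _                    halt          = z≤n
  encode-mono zero    (() , _)             _                    (this _)
  encode-mono zero    (() , _)             _                    (next _ _)
  encode-mono (suc L) {bs = _ ∷ bs} (s≤s len , _ ∷ ok) _ (this a<b) =
    <⇒≤ (encode-head-< L bs (len , ok) a<b)
  encode-mono (suc L) (s≤s len , _ ∷ ok)   (s≤s len′ , _ ∷ ok′) (next refl l) =
    +-monoʳ-≤ _ (encode-mono L (len , ok) (len′ , ok′) l)

  encode-reflects : ∀ L {as bs} → Fits L as → Fits L bs → encode L as ≤ encode L bs → as ≤ₗₑₓ bs
  encode-reflects L       {[]}    {[]}    _ _ _ = base _
  encode-reflects L       {[]}    {_ ∷ _} _ _ _ = halt
  encode-reflects zero    {_ ∷ _} (() , _) _ _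
  encode-reflects (suc L) {a ∷ as} {[]} _ _ le =
    contradiction le (<⇒≱ (<-≤-trans (m^n>0 radix L)
                             (≤-trans (m≤n*m (radix ^ L) (suc a)) (m≤m+n _ _))))
  encode-reflects (suc L) {a ∷ as} {b ∷ bs} (s≤s la , _ ∷ oa) (s≤s lb , _ ∷ ob) le with <-cmp a b
  ... | tri< a<b _ _ = this a<b
  ... | tri≈ _ refl _ = next refl (encode-reflects L (la , oa) (lb , ob) (+-cancelˡ-≤ _ _ _ le))
  ... | tri> _ _ b<a = contradiction le (<⇒≱ (encode-head-< L as (lb , ob) b<a))

  encode-injective : ∀ L {as bs} → Fits L as → Fits L bs → encode L as ≡ encode L bs → as ≡ bs
  encode-injective L fa fb eq =
    ≤ₗₑₓ-antisym (encode-reflects L fa fb (≤-reflexive eq)) (encode-reflects L fb fa (≤-reflexive (sym eq)))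

finiteChoice : ∀ {A B : Set} (R : A → B → Set) (xs : List A) → (∀ {a} → a ∈ₗ xs → Σ B (R a)) →
               Σ (List B) λ ys → (∀ {a} → a ∈ₗ xs → ∃[ b ] b ∈ₗ ys × R a b)
                               × (∀ {b} → b ∈ₗ ys → ∃[ a ] a ∈ₗ xs × R a b)
finiteChoice R []       choose = [] , (λ ()) , (λ ())
finiteChoice R (x ∷ xs) choose with choose (here refl) | finiteChoice R xs (choose ∘ there)
... | y , rxy | ys , forth , back = y ∷ ys , forth′ , back′
  where
  forth′ : ∀ {a} → a ∈ₗ x ∷ xs → ∃[ b ] b ∈ₗ y ∷ ys × R a b
  forth′ (here refl) = y , here refl , rxy
  forth′ (there a∈xs) with forth a∈xs
  ... | b , b∈ys , rab = b , there b∈ys , rab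
  back′ : ∀ {b} → b ∈ₗ y ∷ ys → ∃[ a ] a ∈ₗ x ∷ xs × R a b
  back′ (here refl) = x , here refl , rxy
  back′ (there b∈ys) with back b∈ys
  ... | a , a∈xs , rab = a , there a∈xs , rab

-- Realizations on the integer grid

record GridRect : Set where
  constructor gridRect
  field
    xlo xhi ylo yhi : ℕ
open GridRect

infix 4 _∈ᴳ_

_∈ᴳ_ : ℕ × ℕ → GridRect → Set
(a , b) ∈ᴳ R = (xlo R ≤ a × a ≤ xhi R) × (ylo R ≤ b × b ≤ yhi R)

NestedIntervals : ℕ → ℕ → ℕ → ℕ → Set
NestedIntervals lo hi lo′ hi′ =
  (lo′ ≤ lo × hi ≤ hi′) ⊎ (lo ≤ lo′ × hi′ ≤ hi) ⊎ hi < lo′ ⊎ hi′ < lo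

NestedIntervals-sym : ∀ {lo hi lo′ hi′} → NestedIntervals lo hi lo′ hi′ → NestedIntervals lo′ hi′ lo hi
NestedIntervals-sym (inj₁ ⊆′)               = inj₂ (inj₁ ⊆′)
NestedIntervals-sym (inj₂ (inj₁ ⊇′))        = inj₁ ⊇′
NestedIntervals-sym (inj₂ (inj₂ (inj₁ <′))) = inj₂ (inj₂ (inj₂ <′))
NestedIntervals-sym (inj₂ (inj₂ (inj₂ >′))) = inj₂ (inj₂ (inj₁ >′))

NestedIntervals-shift : ∀ c {lo hi lo′ hi′} → NestedIntervals lo hi lo′ hi′ →
                        NestedIntervals (c + lo) (c + hi) (c + lo′) (c + hi′)
NestedIntervals-shift c (inj₁ (lo , hi))        = inj₁ (+-monoʳ-≤ c lo , +-monoʳ-≤ c hi)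
NestedIntervals-shift c (inj₂ (inj₁ (lo , hi))) = inj₂ (inj₁ (+-monoʳ-≤ c lo , +-monoʳ-≤ c hi))
NestedIntervals-shift c (inj₂ (inj₂ (inj₁ lt))) = inj₂ (inj₂ (inj₁ (+-monoʳ-< c lt)))
NestedIntervals-shift c (inj₂ (inj₂ (inj₂ lt))) = inj₂ (inj₂ (inj₂ (+-monoʳ-< c lt)))

NestedYRanges : GridRect → GridRect → Set
NestedYRanges R R′ = NestedIntervals (ylo R) (yhi R) (ylo R′) (yhi R′)

BoundedBy : ℕ → GridRect → Set
BoundedBy s R = xlo R < s × xhi R < s × ylo R < s × yhi R < s

CutsOut : ∀ {k} → (Fin k → ℕ) → (Fin k → ℕ) → GridRect → Subset k → Set
CutsOut x y R e = ∀ v → v ∈ₛ e ⇔ (x v , y v) ∈ᴳ R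

record GridRealization (H : Hyp) : Set where
  field
    size        : ℕ
    x y         : Fin (n H) → ℕ
    x-injective : Injective _≡_ _≡_ x
    x<size      : ∀ v → x v < size
    y<size      : ∀ v → y v < size
    rects       : List GridRect
    rect<size   : ∀ {R} → R ∈ₗ rects → BoundedBy size R
    nested      : ∀ {R R′} → R ∈ₗ rects → R′ ∈ₗ rects → NestedYRanges R R′
    edge⇒rect   : ∀ {e} → e ∈ₗ edges H → ∃[ R ] R ∈ₗ rects × CutsOut x y R e
    rect⇒edge   : ∀ {R} → R ∈ₗ rects → ∃[ e ] e ∈ₗ edges H × CutsOut x y R e

fromℕ : ℕ → ℚ
fromℕ a = mkℚ (ℤ.+ a) 0 (Coprime.sym (Coprime.1-coprimeTo a))

fromℕ-mono-≤ : ∀ {a b} → a ≤ b → fromℕ a ℚ.≤ fromℕ b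
fromℕ-mono-≤ {a} {b} a≤b =
  *≤* (subst₂ ℤ._≤_ (sym (ℤ.*-identityʳ (ℤ.+ a))) (sym (ℤ.*-identityʳ (ℤ.+ b))) (ℤ.+≤+ a≤b))

fromℕ-cancel-≤ : ∀ {a b} → fromℕ a ℚ.≤ fromℕ b → a ≤ b
fromℕ-cancel-≤ {a} {b} (*≤* le) with subst₂ ℤ._≤_ (ℤ.*-identityʳ (ℤ.+ a)) (ℤ.*-identityʳ (ℤ.+ b)) le
... | ℤ.+≤+ a≤b = a≤b

fromℕ-injective : ∀ {a b} → fromℕ a ≡ fromℕ b → a ≡ b
fromℕ-injective refl = refl

toRect : GridRect → Rect
toRect R = rect (fromℕ (xlo R)) (fromℕ (xhi R)) (fromℕ (ylo R)) (fromℕ (yhi R))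

toPoint : ℕ × ℕ → Point
toPoint (a , b) = fromℕ a , fromℕ b

∈ᴳ⇔∈R : ∀ p R → p ∈ᴳ R ⇔ toPoint p ∈R toRect R
∈ᴳ⇔∈R p R = mk⇔
  (λ ((a , b) , (c , d)) → (fromℕ-mono-≤ a , fromℕ-mono-≤ b) , (fromℕ-mono-≤ c , fromℕ-mono-≤ d))
  (λ ((a , b) , (c , d)) → (fromℕ-cancel-≤ a , fromℕ-cancel-≤ b) , (fromℕ-cancel-≤ c , fromℕ-cancel-≤ d))

NestedYRanges⇒NestedPair : ∀ R R′ → NestedYRanges R R′ → NestedPair (yProj (toRect R)) (yProj (toRect R′))
NestedYRanges⇒NestedPair R R′ (inj₁ (lo , hi)) =
  inj₁ λ _ (a , b) → ℚ.≤-trans (fromℕ-mono-≤ lo) a , ℚ.≤-trans b (fromℕ-mono-≤ hi)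
NestedYRanges⇒NestedPair R R′ (inj₂ (inj₁ (lo , hi))) =
  inj₂ (inj₁ λ _ (a , b) → ℚ.≤-trans (fromℕ-mono-≤ lo) a , ℚ.≤-trans b (fromℕ-mono-≤ hi))
NestedYRanges⇒NestedPair R R′ (inj₂ (inj₂ (inj₁ hi<lo))) =
  inj₂ (inj₂ λ _ ((_ , b) , (c , _)) → <⇒≱ hi<lo (fromℕ-cancel-≤ (ℚ.≤-trans c b)))
NestedYRanges⇒NestedPair R R′ (inj₂ (inj₂ (inj₂ hi<lo))) =
  inj₂ (inj₂ λ _ ((a , _) , (_ , d)) → <⇒≱ hi<lo (fromℕ-cancel-≤ (ℚ.≤-trans a d)))

∈-yProjs⁻ : ∀ {I} Rs → I ∈ₗ yProjs Rs → ∃[ R ] R ∈ₗ Rs × I ≡ yProj R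
∈-yProjs⁻ (R ∷ Rs) (here refl) = R , here refl , refl
∈-yProjs⁻ (R ∷ Rs) (there I∈) with ∈-yProjs⁻ Rs I∈
... | R′ , R′∈ , eq = R′ , there R′∈ , eq

GridRealization⇒NestedRectRealization : ∀ {H} → GridRealization H → NestedRectRealization H
GridRealization⇒NestedRectRealization {H} ρ =
  φ , x-injective ∘ fromℕ-injective ∘ cong proj₁ , map toRect rects , nestedFamily , forth , back
  where
  open GridRealization ρ
  φ : Fin (n H) → Point
  φ v = toPoint (x v , y v)
  lift : ∀ {e R} → CutsOut x y R e → ∀ v → v ∈ₛ e ⇔ φ v ∈R toRect R
  lift cuts v = ⇔.trans (cuts v) (∈ᴳ⇔∈R _ _)
  nestedFamily : NestedFamily (yProjs (map toRect rects))
  nestedFamily A B A∈ B∈ with ∈-yProjs⁻ _ A∈ | ∈-yProjs⁻ _ B∈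
  ... | _ , RA∈ , refl | _ , RB∈ , refl with ∈-map⁻ toRect RA∈ | ∈-map⁻ toRect RB∈
  ... | R , R∈ , refl | R′ , R′∈ , refl = NestedYRanges⇒NestedPair R R′ (nested R∈ R′∈)
  forth : ∀ e → e ∈ₗ edges H → Σ Rect λ R → R ∈ₗ map toRect rects × (∀ v → v ∈ₛ e ⇔ φ v ∈R R)
  forth e e∈ with edge⇒rect e∈
  ... | R , R∈ , cuts = toRect R , ∈-map⁺ toRect R∈ , lift cuts
  back : ∀ R → R ∈ₗ map toRect rects → Σ (Subset (n H)) λ e → e ∈ₗ edges H × (∀ v → v ∈ₛ e ⇔ φ v ∈R R)
  back _ R∈ with ∈-map⁻ toRect R∈
  ... | R , R∈′ , refl with rect⇒edge R∈′
  ... | e , e∈ , cuts = e , e∈ , lift cuts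

-- The forest of stages

module Forest (m top : ℕ) where

  rootIndex : ∀ {h} → Stage m top h → Fin (pw m (suc h)) → Fin (pw m (suc top))
  rootIndex root        i = i
  rootIndex (child S c) i = rootIndex S (combine i (lookup c i))

  rootIndex-injective : ∀ {h} (S : Stage m top h) {i j} → rootIndex S i ≡ rootIndex S j → i ≡ j
  rootIndex-injective root        eq = eq
  rootIndex-injective (child S c) {i} {j} eq =
    proj₁ (combine-injective i (lookup c i) j (lookup c j) (rootIndex-injective S eq))

  vecIndex : ∀ {k} → Vec (Fin m) k → Fin (pw m k)
  vecIndex []       = Fin.zero
  vecIndex (u ∷ us) = combine (vecIndex us) u

  vecIndex-injective : ∀ {k} {us vs : Vec (Fin m) k} → vecIndex us ≡ vecIndex vs → us ≡ vs
  vecIndex-injective {us = []}     {[]}     _  = refl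
  vecIndex-injective {us = u ∷ us} {v ∷ vs} eq with combine-injective (vecIndex us) u (vecIndex vs) v eq
  ... | us≡ , refl = cong (u ∷_) (vecIndex-injective us≡)

  -- The address of a stage lists, from the root down, the choices S′ ∈ f_m(S) made along the way.
  address : ∀ {h} → Stage m top h → List ℕ
  address root        = []
  address (child S c) = address S ∷ʳ toℕ (vecIndex c)

  length-address : ∀ {h} (S : Stage m top h) → length (address S) + h ≡ top
  length-address root              = refl
  length-address {h} (child S c) = begin
    length (address S ∷ʳ _) + h  ≡⟨ cong (_+ h) (trans (length-++ (address S)) (+-comm _ 1)) ⟩
    suc (length (address S)) + h ≡⟨ sym (+-suc _ h) ⟩
    length (address S) + suc h   ≡⟨ length-address S ⟩
    top                          ∎
    where open ≡-Reasoning

  height≤top : ∀ {h} (S : Stage m top h) → h ≤ top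
  height≤top {h} S = subst (h ≤_) (length-address S) (m≤n+m h _)

  length-address≤top : ∀ {h} (S : Stage m top h) → length (address S) ≤ top
  length-address≤top {h} S = subst (length (address S) ≤_) (length-address S) (m≤m+n _ h)

  address-injective : ∀ {h h′} (S : Stage m top h) (S′ : Stage m top h′) →
                      address S ≡ address S′ → (h , S) ≡ (h′ , S′)
  address-injective root        root         _  = refl
  address-injective root        (child S′ c) eq = contradiction (sym eq) (∷ʳ≢[] (address S′))
  address-injective (child S c) root         eq = contradiction eq (∷ʳ≢[] (address S))
  address-injective (child S c) (child S′ c′) eq with ∷ʳ-injective (address S) (address S′) eq
  ... | addr≡ , code≡ with address-injective S S′ addr≡
  ... | refl with vecIndex-injective {us = c} {c′} (toℕ-injective code≡)
  ... | refl = refl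

  data Ancestor {h′} (S′ : Stage m top h′) : ∀ {h} → Stage m top h → Set where
    here  : Ancestor S′ S′
    there : ∀ {h} {S : Stage m top (suc h)} {c} → Ancestor S′ S → Ancestor S′ (child S c)

  Prefix⇒Ancestor : ∀ {h h′} (S′ : Stage m top h′) (S : Stage m top h) →
                    Prefix _≡_ (address S′) (address S) → Ancestor S′ S
  Prefix⇒Ancestor S′ root p with address-injective S′ root (prefix-[]⁻ p)
  ... | refl = here
  Prefix⇒Ancestor S′ (child S c) p with prefix-∷ʳ⁻ (address S) p
  ... | inj₁ p′ = there (Prefix⇒Ancestor S′ S p′)
  ... | inj₂ eq with address-injective S′ (child S c) eq
  ... | refl = here

  InPath⇒Prefix : ∀ {h} (S : Stage m top h) i {h′} {S′ : Stage m top h′} {i′} →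
                  InPath S i (h′ , S′ , i′) →
                  Prefix _≡_ (address S′) (address S) × rootIndex S′ i′ ≡ rootIndex S i
  InPath⇒Prefix root        i refl        = [] , refl
  InPath⇒Prefix (child S c) i (inj₁ refl) = Prefix.fromPointwise (Pointwise.refl refl) , refl
  InPath⇒Prefix (child S c) i (inj₂ p) with InPath⇒Prefix S (combine i (lookup c i)) p
  ... | prefix , root≡ = prefix ++ᵖ _ , root≡

  Ancestor⇒InPath : ∀ {h h′} {S′ : Stage m top h′} {S : Stage m top h} → Ancestor S′ S →
                    ∀ {i′ i} → rootIndex S′ i′ ≡ rootIndex S i → InPath S i (h′ , S′ , i′)
  Ancestor⇒InPath {S = root}      here eq with rootIndex-injective root eq
  ... | refl = refl
  Ancestor⇒InPath {S = child S c} here eq with rootIndex-injective (child S c) eq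
  ... | refl = inj₁ refl
  Ancestor⇒InPath (there anc) eq = inj₂ (Ancestor⇒InPath anc eq)

  -- A child of height h of a stage is determined by one of pw m (pw m (suc h)) choice vectors.
  choiceCount : ℕ → ℕ
  choiceCount h = pw m (pw m (suc h))

  choicesBelow : ℕ → ℕ
  choicesBelow zero    = 0
  choicesBelow (suc t) = choiceCount t + choicesBelow t

  choiceCount≤choicesBelow : ∀ {h t} → h < t → choiceCount h ≤ choicesBelow t
  choiceCount≤choicesBelow {h} {suc t} (s≤s h≤t) with m≤n⇒m<n∨m≡n h≤t
  ... | inj₁ h<t  = ≤-trans (choiceCount≤choicesBelow h<t) (m≤n+m _ _)
  ... | inj₂ refl = m≤m+n _ _

  codeBound : ℕ
  codeBound = choicesBelow top

  address<codeBound : ∀ {h} (S : Stage m top h) → All (_< codeBound) (address S)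
  address<codeBound root        = []
  address<codeBound (child S c) =
    All.++⁺ (address<codeBound S)
            (<-≤-trans (toℕ<n (vecIndex c)) (choiceCount≤choicesBelow (height≤top S)) ∷ [])

remainder-combine : ∀ {k n} (b : Fin k) (u : Fin n) → remainder {k} n (combine b u) ≡ u
remainder-combine b u = cong proj₂ (remQuot-combine b u)

module Digits {m} (x : Fin m → ℕ) where

  xDigits : ∀ k → Fin (pw m k) → List ℕ
  xDigits zero    _ = []
  xDigits (suc k) p = xDigits k (quotient {pw m k} m p) ∷ʳ x (remainder {pw m k} m p)

  xDigits-combine : ∀ k b u → xDigits (suc k) (combine b u) ≡ xDigits k b ∷ʳ x u
  xDigits-combine k b u = cong (λ (q , r) → xDigits k q ∷ʳ x r) (remQuot-combine {pw m k} {m} b u)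

  length-xDigits : ∀ k p → length (xDigits k p) ≡ k
  length-xDigits zero    p = refl
  length-xDigits (suc k) p = trans (length-++ (xDigits k _)) (trans (+-comm _ 1) (cong suc (length-xDigits k _)))

  xDigits-injective : Injective _≡_ _≡_ x → ∀ k {p q} → xDigits k p ≡ xDigits k q → p ≡ q
  xDigits-injective x-inj zero    {Fin.zero} {Fin.zero} _ = refl
  xDigits-injective x-inj (suc k) {p} {q} eq with ∷ʳ-injective (xDigits k _) (xDigits k _) eq
  ... | quot≡ , rem≡ = begin
    p                                                         ≡⟨ sym (combine-remQuot {pw m k} m p) ⟩
    combine (quotient {pw m k} m p) (remainder {pw m k} m p)  ≡⟨ cong₂ combine (xDigits-injective x-inj k quot≡)
                                                                               (x-inj rem≡) ⟩
    combine (quotient {pw m k} m q) (remainder {pw m k} m q)  ≡⟨ combine-remQuot {pw m k} m q ⟩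
    q                                                         ∎
    where open ≡-Reasoning

  xDigits< : ∀ {s} → (∀ u → x u < s) → ∀ k p → All (_< s) (xDigits k p)
  xDigits< x<s zero    p = []
  xDigits< x<s (suc k) p = All.++⁺ (xDigits< x<s k _) (x<s _ ∷ [])

-- From a realization of H_k^{c-1} to one of H_k^c

module Construction {G : Hyp} (ρ : GridRealization G) (top : ℕ) where

  open GridRealization ρ
  open Forest (n G) top
  open Digits x

  m : ℕ
  m = n G

  -- Letters of x-words are x-coordinates of G (< size) and address entries (< codeBound);
  -- maxLetter is strictly above both, which is what the right end of transRect relies on.
  maxLetter : ℕ
  maxLetter = size + codeBound

  open LexEncoding maxLetter

  wordLength : ℕ
  wordLength = suc top + suc (suc top)

  size<radix : size < radix
  size<radix = s≤s (≤-trans (m≤m+n size codeBound) (n≤1+n _))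

  y<radix : ∀ u → y u < radix
  y<radix u = <-trans (y<size u) size<radix

  xDigits<maxLetter : ∀ k p → All (_< maxLetter) (xDigits k p)
  xDigits<maxLetter k p = All.map (λ lt → <-≤-trans lt (m≤m+n size codeBound)) (xDigits< x<size k p)

  address<maxLetter : ∀ {h} (S : Stage m top h) → All (_< maxLetter) (address S)
  address<maxLetter S = All.map (λ lt → <-≤-trans lt (m≤n+m codeBound size)) (address<codeBound S)

  length-xDigits-++ : ∀ {k} p t → k ≤ suc top → length t ≤ suc (suc top) →
                      length (xDigits k p ++ t) ≤ wordLength
  length-xDigits-++ {k} p t k≤ t≤ = begin
    length (xDigits k p ++ t)        ≡⟨ length-++ (xDigits k p) ⟩
    length (xDigits k p) + length t  ≡⟨ cong (_+ length t) (length-xDigits k p) ⟩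
    k + length t                     ≤⟨ +-mono-≤ k≤ t≤ ⟩
    wordLength                       ∎
    where open ≤-Reasoning

  top≤2+top : top ≤ suc (suc top)
  top≤2+top = ≤-trans (n≤1+n top) (n≤1+n _)

  xWord : ∀ {h} → Stage m top h → Fin (pw m (suc h)) → List ℕ
  xWord S i = xDigits (suc top) (rootIndex S i) ++ address S

  xWord<maxLetter : ∀ {h} (S : Stage m top h) i → All (_< maxLetter) (xWord S i)
  xWord<maxLetter S i = All.++⁺ (xDigits<maxLetter (suc top) _) (address<maxLetter S)

  xWord-fits : ∀ {h} (S : Stage m top h) i → Fits wordLength (xWord S i)
  xWord-fits S i = length-xDigits-++ _ _ ≤-refl (≤-trans (length-address≤top S) top≤2+top)
                 , All.map <⇒≤ (xWord<maxLetter S i)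

  xDigits-rootIndex : ∀ {h} (S : Stage m top h) i →
                      ∃[ t ] xDigits (suc top) (rootIndex S i) ≡ xDigits (suc h) i ++ t
  xDigits-rootIndex root i = [] , sym (++-identityʳ _)
  xDigits-rootIndex {h} (child S c) i with xDigits-rootIndex S (combine i (lookup c i))
  ... | t , eq = x (lookup c i) ∷ t , (begin
    xDigits (suc top) (rootIndex S (combine i (lookup c i)))  ≡⟨ eq ⟩
    xDigits (suc (suc h)) (combine i (lookup c i)) ++ t      ≡⟨ cong (_++ t) (xDigits-combine (suc h) i _) ⟩
    xDigits (suc h) i ∷ʳ x (lookup c i) ++ t                 ≡⟨ ∷ʳ-++ (xDigits (suc h) i) _ t ⟩
    xDigits (suc h) i ++ x (lookup c i) ∷ t                  ∎)
    where open ≡-Reasoning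

  xWord-combine : ∀ {h} (S : Stage m top h) b u →
                  ∃[ t ] xWord S (combine b u) ≡ xDigits h b ++ x u ∷ t × All (_< maxLetter) t
  xWord-combine {h} S b u with xDigits-rootIndex S (combine b u)
  ... | t , eq = t ++ address S , word≡ , rest<
    where
    word≡ : xWord S (combine b u) ≡ xDigits h b ++ x u ∷ t ++ address S
    word≡ = begin
      xDigits (suc top) (rootIndex S (combine b u)) ++ address S  ≡⟨ cong (_++ address S) eq ⟩
      (xDigits (suc h) (combine b u) ++ t) ++ address S          ≡⟨ cong (λ ws → (ws ++ t) ++ address S) (xDigits-combine h b u) ⟩
      ((xDigits h b ∷ʳ x u) ++ t) ++ address S                   ≡⟨ cong (_++ address S) (∷ʳ-++ (xDigits h b) (x u) t) ⟩
      (xDigits h b ++ x u ∷ t) ++ address S                      ≡⟨ ++-assoc (xDigits h b) _ (address S) ⟩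
      xDigits h b ++ x u ∷ t ++ address S                        ∎
      where open ≡-Reasoning
    rest< : All (_< maxLetter) (t ++ address S)
    rest< with All.++⁻ʳ (xDigits h b) (subst (All (_< maxLetter)) word≡ (xWord<maxLetter S (combine b u)))
    ... | _ ∷ rest = rest

  band : ∀ {h} → Stage m top h → List ℕ
  band S = map (codeBound ∸_) (address S)

  band-fits : ∀ {h} (S : Stage m top h) → Fits wordLength (band S)
  band-fits S = ≤-trans (≤-reflexive (length-map _ (address S)))
                        (≤-trans (length-address≤top S) (≤-trans top≤2+top (m≤n+m _ (suc top))))
              , All.map⁺ (All.tabulate λ {a} _ → ≤-trans (m∸n≤m codeBound a) (m≤n+m codeBound size))

  level : ∀ {h} → Stage m top h → ℕ
  level S = encode wordLength (band S)

  level-injective : ∀ {h h′} (S : Stage m top h) (S′ : Stage m top h′) → level S ≡ level S′ → (h , S) ≡ (h′ , S′)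
  level-injective S S′ eq =
    address-injective S S′ (map-∸-injective codeBound (All.map <⇒≤ (address<codeBound S))
                                                        (All.map <⇒≤ (address<codeBound S′))
                              (encode-injective wordLength (band-fits S) (band-fits S′) eq))

  X : Vtx m top → ℕ
  X (_ , S , i) = encode wordLength (xWord S i)

  Y : Vtx m top → ℕ
  Y (h , S , i) = level S * radix + y (remainder {pw m h} m i)

  gridSize : ℕ
  gridSize = radix ^ wordLength * radix

  encode<gridSize : ∀ {ws} → Fits wordLength ws → encode wordLength ws < gridSize
  encode<gridSize fits = <-≤-trans (encode<radix^ wordLength fits) (m≤m*n _ radix)

  X<gridSize : ∀ w → X w < gridSize
  X<gridSize (_ , S , i) = encode<gridSize (xWord-fits S i)

  level*radix+<gridSize : ∀ {h} (S : Stage m top h) {a} → a < radix → level S * radix + a < gridSize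
  level*radix+<gridSize S = positional-bound (encode<radix^ wordLength (band-fits S))

  Y<gridSize : ∀ w → Y w < gridSize
  Y<gridSize (_ , S , i) = level*radix+<gridSize S (y<radix _)

  X-injective : ∀ {w w′} → X w ≡ X w′ → w ≡ w′
  X-injective {h , S , i} {h′ , S′ , i′} eq
    with ++-cancel-equalLength (xDigits (suc top) _) (xDigits (suc top) _)
           (trans (length-xDigits (suc top) _) (sym (length-xDigits (suc top) _)))
           (encode-injective wordLength (xWord-fits S i) (xWord-fits S′ i′) eq)
  ... | digits≡ , address≡ with address-injective S S′ address≡
  ... | refl with rootIndex-injective S (xDigits-injective x-injective (suc top) digits≡)
  ... | refl = refl

  pathRect : Stage m top 0 → Fin (pw m 1) → GridRect
  pathRect S i = gridRect (X (top , root , rootIndex S i)) (X (0 , S , i)) 0 (level S * radix + size)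

  transRect : ∀ {h} → Stage m top h → Fin (pw m h) → GridRect → GridRect
  transRect {h} S b R = gridRect (encode wordLength (xDigits h b ∷ʳ xlo R))
                                 (encode wordLength (xDigits h b ++ xhi R ∷ maxLetter ∷ []))
                                 (level S * radix + ylo R) (level S * radix + yhi R)

  lowerWord-fits : ∀ {h} (S : Stage m top h) b {a} → a < size → Fits wordLength (xDigits h b ∷ʳ a)
  lowerWord-fits {h} S b a<size =
    length-xDigits-++ b _ (≤-trans (height≤top S) (n≤1+n top)) (s≤s z≤n)
    , All.++⁺ (All.map <⇒≤ (xDigits<maxLetter h b)) (≤-trans (<⇒≤ a<size) (m≤m+n size codeBound) ∷ [])

  upperWord-fits : ∀ {h} (S : Stage m top h) b {a} → a < size → Fits wordLength (xDigits h b ++ a ∷ maxLetter ∷ [])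
  upperWord-fits {h} S b a<size =
    length-xDigits-++ b _ (≤-trans (height≤top S) (n≤1+n top)) (s≤s (s≤s z≤n))
    , All.++⁺ (All.map <⇒≤ (xDigits<maxLetter h b)) (≤-trans (<⇒≤ a<size) (m≤m+n size codeBound) ∷ ≤-refl ∷ [])

  pathRect-forth : ∀ (S : Stage m top 0) i w → InPath S i w → (X w , Y w) ∈ᴳ pathRect S i
  pathRect-forth S i (h′ , S′ , i′) p with InPath⇒Prefix S i p
  ... | prefix , root≡ = (lower , upper) , (z≤n , yUpper)
    where
    r : Fin (pw m (suc top))
    r = rootIndex S i
    word≡ : xWord S′ i′ ≡ xDigits (suc top) r ++ address S′
    word≡ = cong (λ j → xDigits (suc top) j ++ address S′) root≡
    lower : X (top , root , r) ≤ X (h′ , S′ , i′)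
    lower = encode-mono wordLength (xWord-fits root r) (xWord-fits S′ i′)
              (subst (xWord root r ≤ₗₑₓ_) (sym word≡) (Lex-≤-++⁺ˡ (xDigits (suc top) r) (Prefix⇒Lex-≤ [])))
    upper : X (h′ , S′ , i′) ≤ X (0 , S , i)
    upper = encode-mono wordLength (xWord-fits S′ i′) (xWord-fits S i)
              (subst (_≤ₗₑₓ xWord S i) (sym word≡) (Lex-≤-++⁺ˡ (xDigits (suc top) r) (Prefix⇒Lex-≤ prefix)))
    yUpper : Y (h′ , S′ , i′) ≤ level S * radix + size
    yUpper = +-mono-≤ (*-monoˡ-≤ radix (encode-mono wordLength (band-fits S′) (band-fits S)
                        (Prefix⇒Lex-≤ (Prefix.map⁺ _ _ (Prefix-map (cong (codeBound ∸_)) prefix)))))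
                      (<⇒≤ (y<size _))

  pathRect-back : ∀ (S : Stage m top 0) i w → (X w , Y w) ∈ᴳ pathRect S i → InPath S i w
  pathRect-back S i (h′ , S′ , i′) ((lower , upper) , (_ , yUpper)) =
    Ancestor⇒InPath (Prefix⇒Ancestor S′ S (Lex-≤-both⇒Prefix <-asym addresses bands)) root≡
    where
    r r′ : Fin (pw m (suc top))
    r  = rootIndex S i
    r′ = rootIndex S′ i′
    lower′ : xWord root r ≤ₗₑₓ xWord S′ i′
    lower′ = encode-reflects wordLength (xWord-fits root r) (xWord-fits S′ i′) lower
    upper′ : xWord S′ i′ ≤ₗₑₓ xWord S i
    upper′ = encode-reflects wordLength (xWord-fits S′ i′) (xWord-fits S i) upper
    sameLength : length (xDigits (suc top) r′) ≡ length (xDigits (suc top) r)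
    sameLength = trans (length-xDigits (suc top) r′) (sym (length-xDigits (suc top) r))
    root≡ : r′ ≡ r
    root≡ = xDigits-injective x-injective (suc top)
              (≤ₗₑₓ-antisym (Lex-≤-++-equalLength sameLength upper′)
                            (Lex-≤-++-equalLength (sym sameLength) lower′))
    addresses : address S′ ≤ₗₑₓ address S
    addresses = Lex-≤-++⁻ˡ <-irrefl (xDigits (suc top) r)
                  (subst (λ j → xDigits (suc top) j ++ address S′ ≤ₗₑₓ xWord S i) root≡ upper′)
    bands : Lex-≤ _≡_ _>_ (address S′) (address S)
    bands = map-∸-≤ₗₑₓ⁻ codeBound (All.map <⇒≤ (address<codeBound S′)) (All.map <⇒≤ (address<codeBound S))
              (encode-reflects wordLength (band-fits S′) (band-fits S) (positional-≤⁻ size<radix yUpper))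

  transRect-forth : ∀ {h} (S : Stage m top h) b {R} → BoundedBy size R →
                    ∀ u → (x u , y u) ∈ᴳ R → (X (h , S , combine b u) , Y (h , S , combine b u)) ∈ᴳ transRect S b R
  transRect-forth {h} S b {R} (xlo< , xhi< , _) u ((xlo≤ , ≤xhi) , (ylo≤ , ≤yhi)) with xWord-combine S b u
  ... | t , word≡ , t< = (lower , upper) , (yLower , yUpper)
    where
    fits : Fits wordLength (xWord S (combine b u))
    fits = xWord-fits S (combine b u)
    lower : encode wordLength (xDigits h b ∷ʳ xlo R) ≤ X (h , S , combine b u)
    lower = encode-mono wordLength (lowerWord-fits S b xlo<) fits
              (subst (xDigits h b ∷ʳ xlo R ≤ₗₑₓ_) (sym word≡) (Lex-≤-++⁺ˡ (xDigits h b) (singleton-≤ₗₑₓ t xlo≤)))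
    upper : X (h , S , combine b u) ≤ encode wordLength (xDigits h b ++ xhi R ∷ maxLetter ∷ [])
    upper = encode-mono wordLength fits (upperWord-fits S b xhi<)
              (subst (_≤ₗₑₓ xDigits h b ++ xhi R ∷ maxLetter ∷ []) (sym word≡)
                     (Lex-≤-++⁺ˡ (xDigits h b) (∷-≤ₗₑₓ-sentinel ≤xhi t<)))
    y≡ : y (remainder {pw m h} m (combine b u)) ≡ y u
    y≡ = cong y (remainder-combine b u)
    yLower : level S * radix + ylo R ≤ Y (h , S , combine b u)
    yLower = +-monoʳ-≤ (level S * radix) (subst (ylo R ≤_) (sym y≡) ylo≤)
    yUpper : Y (h , S , combine b u) ≤ level S * radix + yhi R
    yUpper = +-monoʳ-≤ (level S * radix) (subst (_≤ yhi R) (sym y≡) ≤yhi)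

  transRect-back-block : ∀ {h} (S : Stage m top h) b {R} → BoundedBy size R → ∀ b′ u →
                         (X (h , S , combine b′ u) , Y (h , S , combine b′ u)) ∈ᴳ transRect S b R →
                         b′ ≡ b × (x u , y u) ∈ᴳ R
  transRect-back-block {h} S b {R} (xlo< , xhi< , _) b′ u ((lower , upper) , (yLower , yUpper))
    with xWord-combine S b′ u
  ... | t , word≡ , _ = block≡ , (≤ₗₑₓ-head lower″ , ≤ₗₑₓ-head upper″) , (yLower′ , yUpper′)
    where
    fits : Fits wordLength (xDigits h b′ ++ x u ∷ t)
    fits = subst (Fits wordLength) word≡ (xWord-fits S (combine b′ u))
    lower′ : xDigits h b ++ [ xlo R ] ≤ₗₑₓ xDigits h b′ ++ x u ∷ t
    lower′ = encode-reflects wordLength (lowerWord-fits S b xlo<) fits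
               (subst (λ ws → encode wordLength (xDigits h b ∷ʳ xlo R) ≤ encode wordLength ws) word≡ lower)
    upper′ : xDigits h b′ ++ x u ∷ t ≤ₗₑₓ xDigits h b ++ xhi R ∷ maxLetter ∷ []
    upper′ = encode-reflects wordLength fits (upperWord-fits S b xhi<)
               (subst (λ ws → encode wordLength ws ≤ encode wordLength (xDigits h b ++ xhi R ∷ maxLetter ∷ []))
                      word≡ upper)
    sameLength : length (xDigits h b) ≡ length (xDigits h b′)
    sameLength = trans (length-xDigits h b) (sym (length-xDigits h b′))
    block≡ : b′ ≡ b
    block≡ = xDigits-injective x-injective h
               (≤ₗₑₓ-antisym (Lex-≤-++-equalLength (sym sameLength) upper′)
                             (Lex-≤-++-equalLength sameLength lower′))
    lower″ : [ xlo R ] ≤ₗₑₓ x u ∷ t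
    lower″ = Lex-≤-++⁻ˡ <-irrefl (xDigits h b)
      (subst (λ c → xDigits h b ++ [ xlo R ] ≤ₗₑₓ xDigits h c ++ x u ∷ t) block≡ lower′)
    upper″ : x u ∷ t ≤ₗₑₓ xhi R ∷ maxLetter ∷ []
    upper″ = Lex-≤-++⁻ˡ <-irrefl (xDigits h b)
      (subst (λ c → xDigits h c ++ x u ∷ t ≤ₗₑₓ xDigits h b ++ xhi R ∷ maxLetter ∷ []) block≡ upper′)
    y≡ : y (remainder {pw m h} m (combine b′ u)) ≡ y u
    y≡ = cong y (remainder-combine b′ u)
    yLower′ : ylo R ≤ y u
    yLower′ = subst (ylo R ≤_) y≡ (+-cancelˡ-≤ (level S * radix) _ _ yLower)
    yUpper′ : y u ≤ yhi R
    yUpper′ = subst (_≤ yhi R) y≡ (+-cancelˡ-≤ (level S * radix) _ _ yUpper)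

  transRect-back : ∀ {h} (S : Stage m top h) b {R} → BoundedBy size R → ∀ w → (X w , Y w) ∈ᴳ transRect S b R →
                   ∃[ u ] (x u , y u) ∈ᴳ R × w ≡ (h , S , combine b u)
  transRect-back {h} S b {R} bounds@(_ , _ , _ , yhi<) (h′ , S′ , i′) inside@(_ , (yLower , yUpper))
    with level-injective S S′ (≤-antisym (positional-≤⁻ (y<radix _) yLower)
                                         (positional-≤⁻ (<-trans yhi< size<radix) yUpper))
  ... | refl with transRect-back-block S b bounds (quotient {pw m h} m i′) (remainder {pw m h} m i′)
                    (subst (λ j → (X (h , S , j) , Y (h , S , j)) ∈ᴳ transRect S b R)
                           (sym (combine-remQuot {pw m h} m i′)) inside)
  ... | refl , u∈R =
    remainder {pw m h} m i′ , u∈R , cong (λ j → h , S , j) (sym (combine-remQuot {pw m h} m i′))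

  pathRect-transRect-nested : ∀ (L : Stage m top 0) i {h} (S : Stage m top h) b R → BoundedBy size R →
                              NestedYRanges (pathRect L i) (transRect S b R)
  pathRect-transRect-nested L i S b R (_ , _ , _ , yhi<) with ≤-<-connex (level S) (level L)
  ... | inj₁ S≤L = inj₂ (inj₁ (z≤n , +-mono-≤ (*-monoˡ-≤ radix S≤L) (<⇒≤ yhi<)))
  ... | inj₂ L<S = inj₂ (inj₂ (inj₁ (positional-< (ylo R) size<radix L<S)))

  transRect-nested : ∀ {h h′} (S : Stage m top h) b (S′ : Stage m top h′) b′ R R′ →
                     BoundedBy size R → BoundedBy size R′ → NestedYRanges R R′ →
                     NestedYRanges (transRect S b R) (transRect S′ b′ R′)
  transRect-nested S b S′ b′ R R′ (_ , _ , _ , yhi<) (_ , _ , _ , yhi′<) nest with <-cmp (level S) (level S′)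
  ... | tri< lt _ _ = inj₂ (inj₂ (inj₁ (positional-< (ylo R′) (<-trans yhi< size<radix) lt)))
  ... | tri> _ _ gt = inj₂ (inj₂ (inj₂ (positional-< (ylo R) (<-trans yhi′< size<radix) gt)))
  ... | tri≈ _ eq _ rewrite eq = NestedIntervals-shift (level S′ * radix) nest

  rectFor : FEdge G top → GridRect
  rectFor (pathE S i)         = pathRect S i
  rectFor (transE _ S b _ e∈) = transRect S b (proj₁ (edge⇒rect e∈))

  rectFor-cuts : ∀ f w → memF f w ⇔ (X w , Y w) ∈ᴳ rectFor f
  rectFor-cuts (pathE S i) w = mk⇔ (pathRect-forth S i w) (pathRect-back S i w)
  rectFor-cuts (transE h S b e e∈) w with edge⇒rect e∈
  ... | R , R∈ , cuts = mk⇔ forth back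
    where
    forth : memF (transE h S b e e∈) w → (X w , Y w) ∈ᴳ transRect S b R
    forth (u , u∈e , refl) = transRect-forth S b (rect<size R∈) u (Equivalence.to (cuts u) u∈e)
    back : (X w , Y w) ∈ᴳ transRect S b R → memF (transE h S b e e∈) w
    back inside with transRect-back S b (rect<size R∈) w inside
    ... | u , u∈R , w≡ = u , Equivalence.from (cuts u) u∈R , w≡

  rectFor-bounded : ∀ f → BoundedBy gridSize (rectFor f)
  rectFor-bounded (pathE S i) =
    X<gridSize (top , root , rootIndex S i) , X<gridSize (0 , S , i) ,
    ≤-<-trans z≤n (X<gridSize (0 , S , i)) , level*radix+<gridSize S size<radix
  rectFor-bounded (transE _ S b _ e∈) with edge⇒rect e∈
  ... | R , R∈ , _ with rect<size R∈
  ... | xlo< , xhi< , ylo< , yhi< =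
    encode<gridSize (lowerWord-fits S b xlo<) , encode<gridSize (upperWord-fits S b xhi<) ,
    level*radix+<gridSize S (<-trans ylo< size<radix) , level*radix+<gridSize S (<-trans yhi< size<radix)

  rectFor-nested : ∀ f f′ → NestedYRanges (rectFor f) (rectFor f′)
  rectFor-nested (pathE S i) (pathE S′ i′) with ≤-total (level S * radix + size) (level S′ * radix + size)
  ... | inj₁ le = inj₁ (z≤n , le)
  ... | inj₂ ge = inj₂ (inj₁ (z≤n , ge))
  rectFor-nested (pathE L i) (transE _ S b _ e∈) with edge⇒rect e∈
  ... | R , R∈ , _ = pathRect-transRect-nested L i S b R (rect<size R∈)
  rectFor-nested (transE _ S b _ e∈) (pathE L i) with edge⇒rect e∈
  ... | R , R∈ , _ = NestedIntervals-sym (pathRect-transRect-nested L i S b R (rect<size R∈))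
  rectFor-nested (transE _ S b _ e∈) (transE _ S′ b′ _ e∈′) with edge⇒rect e∈ | edge⇒rect e∈′
  ... | R , R∈ , _ | R′ , R′∈ , _ =
    transRect-nested S b S′ b′ R R′ (rect<size R∈) (rect<size R′∈) (nested R∈ R′∈)

step-gridRealization : ∀ {k G H} → BuiltFrom k G H → GridRealization G → GridRealization H
step-gridRealization {k} {G} {H} built ρ = record
  { size        = gridSize
  ; x           = X ∘ to
  ; y           = Y ∘ to
  ; x-injective = Injection.injective (↔⇒↣ β) ∘ X-injective
  ; x<size      = X<gridSize ∘ to
  ; y<size      = Y<gridSize ∘ to
  ; rects       = map rectFor chosen
  ; rect<size   = bounded
  ; nested      = nestedRects
  ; edge⇒rect   = edgeRect
  ; rect⇒edge   = rectEdge
  }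
  where
  open BuiltFrom built
  open Inverse β
  open Construction ρ (k ∸ 1)

  Realizes : Subset (n H) → FEdge G (k ∸ 1) → Set
  Realizes e f = ∀ v → v ∈ₛ e ⇔ memF f (to v)

  chosen : List (FEdge G (k ∸ 1))
  chosen = proj₁ (finiteChoice Realizes (edges H) (edges⊆ _))

  chosen-complete : ∀ {e} → e ∈ₗ edges H → ∃[ f ] f ∈ₗ chosen × Realizes e f
  chosen-complete = proj₁ (proj₂ (finiteChoice Realizes (edges H) (edges⊆ _)))

  chosen-sound : ∀ {f} → f ∈ₗ chosen → ∃[ e ] e ∈ₗ edges H × Realizes e f
  chosen-sound = proj₂ (proj₂ (finiteChoice Realizes (edges H) (edges⊆ _)))

  cuts : ∀ {e} f → Realizes e f → CutsOut (X ∘ to) (Y ∘ to) (rectFor f) e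
  cuts f realizes v = ⇔.trans (realizes v) (rectFor-cuts f (to v))

  bounded : ∀ {R} → R ∈ₗ map rectFor chosen → BoundedBy gridSize R
  bounded R∈ with ∈-map⁻ rectFor R∈
  ... | f , _ , refl = rectFor-bounded f

  nestedRects : ∀ {R R′} → R ∈ₗ map rectFor chosen → R′ ∈ₗ map rectFor chosen → NestedYRanges R R′
  nestedRects R∈ R′∈ with ∈-map⁻ rectFor R∈ | ∈-map⁻ rectFor R′∈
  ... | f , _ , refl | f′ , _ , refl = rectFor-nested f f′

  edgeRect : ∀ {e} → e ∈ₗ edges H → ∃[ R ] R ∈ₗ map rectFor chosen × CutsOut (X ∘ to) (Y ∘ to) R e
  edgeRect e∈ with chosen-complete e∈
  ... | f , f∈ , realizes = rectFor f , ∈-map⁺ rectFor f∈ , cuts f realizes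

  rectEdge : ∀ {R} → R ∈ₗ map rectFor chosen → ∃[ e ] e ∈ₗ edges H × CutsOut (X ∘ to) (Y ∘ to) R e
  rectEdge R∈ with ∈-map⁻ rectFor R∈
  ... | f , f∈ , refl with chosen-sound f∈
  ... | e , e∈ , realizes = e , e∈ , cuts f realizes

base-gridRealization : ∀ k → GridRealization (record { n = k ; edges = ⊤ ∷ [] })
base-gridRealization k = record
  { size        = suc k
  ; x           = toℕ
  ; y           = toℕ
  ; x-injective = toℕ-injective
  ; x<size      = m<n⇒m<1+n ∘ toℕ<n
  ; y<size      = m<n⇒m<1+n ∘ toℕ<n
  ; rects       = gridRect 0 k 0 k ∷ []
  ; rect<size   = λ { (here refl) → z<s , n<1+n k , z<s , n<1+n k }
  ; nested      = λ { (here refl) (here refl) → inj₁ (≤-refl , ≤-refl) }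
  ; edge⇒rect   = λ { (here refl) → _ , here refl , whole }
  ; rect⇒edge   = λ { (here refl) → ⊤ , here refl , whole }
  }
  where
  whole : CutsOut toℕ toℕ (gridRect 0 k 0 k) ⊤
  whole v = mk⇔ (λ _ → (z≤n , v≤k) , (z≤n , v≤k)) (λ _ → ∈⊤)
    where
    v≤k : toℕ v ≤ k
    v≤k = <⇒≤ (toℕ<n v)

IsH⇒GridRealization : ∀ {k c H} → IsH k c H → GridRealization H
IsH⇒GridRealization {k} base        = base-gridRealization k
IsH⇒GridRealization (step isH built) = step-gridRealization built (IsH⇒GridRealization isH)

-- The construction works for all k and c.
lemma3 : (c k : ℕ) → 1 ≤ c → 1 ≤ k → (H : Hyp) → IsH k c H → NestedRectRealization H
lemma3 c k _ _ H isH = GridRealization⇒NestedRectRealization (IsH⇒GridRealization isH)
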